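{- Let $G=(V,E)$ be a graph and let $q\in \mathbb{N}$. Let $\mathcal{C}=\{C_1,\ldots,C_r\}$ be an even generating set for the space of $\mathbb{Z}_q$-flows on $G$, and let $e\in E$ be a non-loop edge. Then $\mathcal{C}'=\{C_1/e,\ldots,C_r/e\}$ is an even generating set for the space of $\mathbb{Z}_q$-flows on $G/e$, and $d(\mathcal{C}')\leq d(\mathcal{C})$, $\iota(\mathcal{C}')\leq \iota(\mathcal{C})$, $\ell(\mathcal{C}')\leq \ell(\mathcal{C})$ and $s(\mathcal{C}')\leq s(\mathcal{C})$.
   Context: Graphs are finite multigraphs with a fixed orientation; subgraphs are identified with edge sets. For a subgraph $H$ and edge $e$, $H/e$ is obtained by contracting $e$ (if $e\notin H$, $H/e=H$). A $\mathbb{Z}_q$-flow is $f:E\to\mathbb{Z}_q$ with inflow equal to outflow at every vertex. For an even subgraph $C$ (all degrees even), choose an Eulerian orientation of each component of $C$ and let $\chi_C(e)=0$ for $e\notin C$, $\chi_C(e)=\pm1$ for $e\in C$ according to whether the orientation agrees with that of $G$. An even generating set for the $\mathbb{Z}_q$-flows is a set $\mathcal{C}$ of even subgraphs such that the vectors $\chi_C$ (mod $q$) generate the $\mathbb{Z}_q$-module of $\mathbb{Z}_q$-flows. Parameters: $d(\mathcal{C})=\max_{C}|\{D\in\mathcal{C}\setminus\{C\}:C\cap D\ne\emptyset\}|$; $\iota(\mathcal{C})=\max_{C_1\ne C_2}|C_1\cap C_2|$; $\ell(\mathcal{C})=\max_C|C|$; $s(\mathcal{C})=\max_{e\in E}|\{C\in\mathcal{C}:e\in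 C\}|$. -}

module Defs where

open import Data.Nat as ℕ using (ℕ; zero; suc; _⊔_)
open import Data.Integer as ℤ using (ℤ; +_; _*_; _-_; 0ℤ; 1ℤ; -1ℤ)
open import Data.Integer.Divisibility using (_∣_)
open import Data.Fin using (Fin; zero; suc; punchIn; punchOut; _≟_)
open import Data.Fin.Subset using (Subset; _∩_; ∣_∣)
open import Data.Vec using (lookup; tabulate)
open import Data.Bool using (Bool; true; false; if_then_else_)
open import Data.Product using (Σ; _×_)
open import Data.Sum using (_⊎_)
open import Relation.Nullary using (does; yes; no)
open import Relation.Binary.PropositionalEquality using (_≡_; _≢_)

-- Finite sums / maxima (max over an empty index set is 0)

∑ℤ : ∀ {k} → (Fin k → ℤ) → ℤ
∑ℤ {zero}  f = 0ℤ
∑ℤ {suc k} f = f zero ℤ.+ ∑ℤ (λ i → f (suc i))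

∑ℕ : ∀ {k} → (Fin k → ℕ) → ℕ
∑ℕ {zero}  f = 0
∑ℕ {suc k} f = f zero ℕ.+ ∑ℕ (λ i → f (suc i))

maxℕ : ∀ {k} → (Fin k → ℕ) → ℕ
maxℕ {zero}  f = 0
maxℕ {suc k} f = f zero ⊔ maxℕ (λ i → f (suc i))

-- Finite multigraphs with a fixed orientation: n vertices, m edges,
-- edge x goes from tl x to hd x (loops allowed, parallel edges allowed).

record Graph (n m : ℕ) : Set where
  field
    tl hd : Fin m → Fin n
open Graph public

-- Subgraphs are identified with edge sets.
SubG : ℕ → Set
SubG m = Subset m

-- degree of vertex v in subgraph H (a loop counts twice)
deg : ∀ {n m} → Graph n m → SubG m → Fin n → ℕ
deg G H v = ∑ℕ (λ x → if lookup H x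
                         then (if does (hd G x ≟ v) then 1 else 0)
                              ℕ.+ (if does (tl G x ≟ v) then 1 else 0)
                         else 0)

IsEven : ∀ {n m} → Graph n m → SubG m → Set
IsEven G H = ∀ v → Σ ℕ (λ k → deg G H v ≡ 2 ℕ.* k)

netflow : ∀ {n m} → Graph n m → (Fin m → ℤ) → Fin n → ℤ
netflow G f v = ∑ℤ (λ x → (if does (hd G x ≟ v) then f x else 0ℤ)
                          - (if does (tl G x ≟ v) then f x else 0ℤ))

-- ℤ_q is represented by ℤ modulo q (q = 0 gives ℤ itself).
-- A ℤ_q-flow: inflow ≡ outflow (mod q) at every vertex.
IsFlowMod : ∀ {n m} → Graph n m → ℕ → (Fin m → ℤ) → Set
IsFlowMod G q f = ∀ v → (+ q) ∣ netflow G f v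

-- χ is the signed vector of an Eulerian orientation of H:
-- χ e = ±1 on H (sign: orientation agrees/disagrees with G), 0 off H,
-- and in-degree = out-degree at every vertex for the chosen orientation.
IsEulerChi : ∀ {n m} → Graph n m → SubG m → (Fin m → ℤ) → Set
IsEulerChi G H χ =
  (∀ x → lookup H x ≡ true → (χ x ≡ 1ℤ) ⊎ (χ x ≡ -1ℤ)) ×
  (∀ x → lookup H x ≡ false → χ x ≡ 0ℤ) ×
  (∀ v → netflow G χ v ≡ 0ℤ)

Generates : ∀ {n m r} → Graph n m → ℕ → (Fin r → Fin m → ℤ) → Set
Generates {m = m} {r = r} G q χ =
  ∀ (f : Fin m → ℤ) → IsFlowMod G q f →
    Σ (Fin r → ℤ) (λ a → ∀ x → (+ q) ∣ (f x - ∑ℤ (λ i → a i * χ i x)))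

-- An even generating set {C_1,…,C_r} (indexed family) for the ℤ_q-flows:
-- each C_i is even, and for some choice of Eulerian orientations the
-- vectors χ_{C_i} generate the ℤ_q-flows.
EvenGenSet : ∀ {n m r} → Graph n m → ℕ → (Fin r → SubG m) → Set
EvenGenSet {m = m} {r = r} G q C =
  (∀ i → IsEven G (C i)) ×
  Σ (Fin r → Fin m → ℤ) (λ χ → (∀ i → IsEulerChi G (C i) (χ i)) × Generates G q χ)

-- Contraction of a non-loop edge e.  The vertices hd e and tl e are
-- merged (into the image of tl e); edge e is deleted; the remaining
-- edges of G are re-indexed by Fin m via punchIn e.

mergeV : ∀ {n} {h t : Fin (suc n)} → h ≢ t → Fin (suc n) → Fin n
mergeV {h = h} h≢t v with h ≟ v
... | yes _   = punchOut h≢t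
... | no h≢v = punchOut h≢v

contract : ∀ {n m} (G : Graph (suc n) (suc m)) (e : Fin (suc m)) →
           hd G e ≢ tl G e → Graph n m
contract G e nl = record
  { tl = λ x → mergeV nl (tl G (punchIn e x))
  ; hd = λ x → mergeV nl (hd G (punchIn e x)) }

-- H/e as a subgraph of G/e (i.e. H with e removed)
contractSub : ∀ {m} → Fin (suc m) → SubG (suc m) → SubG m
contractSub e H = tabulate (λ x → lookup H (punchIn e x))

nonempty? : ∀ {m} → SubG m → Bool
nonempty? H with ∣ H ∣
... | zero  = false
... | suc _ = true

dPar : ∀ {m r} → (Fin r → SubG m) → ℕ
dPar C = maxℕ (λ i → ∑ℕ (λ j →
           if does (i ≟ j) then 0
           else (if nonempty? (C i ∩ C j) then 1 else 0)))

ιPar : ∀ {m r} → (Fin r → SubG m) → ℕ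
ιPar C = maxℕ (λ i → maxℕ (λ j →
           if does (i ≟ j) then 0 else ∣ C i ∩ C j ∣))

ℓPar : ∀ {m r} → (Fin r → SubG m) → ℕ
ℓPar C = maxℕ (λ i → ∣ C i ∣)

sPar : ∀ {m r} → (Fin r → SubG m) → ℕ
sPar C = maxℕ (λ x → ∑ℕ (λ i → if lookup (C i) x then 1 else 0))

{-# OPTIONS --safe #-}

-- Contracting a non-loop edge e = (t → h) factors as deleting e and then relabelling the
-- vertices along mergeV, which identifies h with t and is injective elsewhere. Net flows and
-- degrees in a relabelled graph are sums over fibres, so at the merged vertex they are the sums
-- of those of G ∖ e at h and at t, and elsewhere they are those of G ∖ e. Putting e back adds
-- ±f(e) to the net flows at h and t, which cancel, and [e ∈ H] to both degrees, which adds up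
-- to an even number; hence restricted Eulerian vectors stay balanced and even subgraphs stay
-- even. A ℤ_q-flow on G / e becomes a ℤ_q-flow on G by giving e the value that balances h:
-- the net flow at t is then that of the merged vertex. Restricting to E ∖ e the combination
-- of the χ_C that generates this flow generates the original one. Finally each C_i / e is C_i
-- with at most one edge removed, so the four parameters can only decrease.

module Submission where

open import Defs
open import Algebra.Bundles using (Monoid)
import Algebra.Properties.CommutativeMonoid.Sum as MonoidSum
import Algebra.Properties.CommutativeSemigroup as CommutativeSemigroupProperties
open import Data.Bool using (true; false; if_then_else_; _∧_; _∨_; T)
open import Data.Empty using (⊥-elim)
open import Data.Fin using (Fin; zero; suc; punchIn; punchOut; _≟_)
open import Data.Fin.Properties using (punchOut-cong; punchOut-injective; punchOut-punchIn; punchInᵢ≢i)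
open import Data.Fin.Subset using (Subset; _∩_; ∣_∣)
open import Data.Integer as ℤ using (ℤ; +_; 0ℤ; _-_)
open import Data.Integer.Divisibility using () renaming (_∣_ to _∣ℤ_)
import Data.Integer.Properties as ℤP
open import Data.Nat as ℕ using (ℕ; zero; suc; _≤_; z≤n; s≤s)
open import Data.Nat.Divisibility as ℕD using (divides; _∣0; ∣m+n∣m⇒∣n; ∣m∣n⇒∣m+n)
import Data.Nat.Properties as ℕP
open import Data.Product using (Σ; _×_; _,_)
open import Data.Sum using (_⊎_; inj₁; inj₂)
open import Data.Unit using (tt)
open import Data.Vec using (_∷_; lookup)
open import Data.Vec.Functional using (removeAt; insertAt)
open import Data.Vec.Functional.Properties using (insertAt-lookup; insertAt-punchIn; removeAt-insertAt)
open import Data.Vec.Properties using (lookup∘tabulate; tabulate∘lookup; tabulate-cong; lookup-zipWith)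
open import Function using (_∘_; _⇔_; mk⇔; case_of_)
open import Relation.Nullary using (¬_; Dec; does; yes; no)
open import Relation.Nullary.Decidable using (does-⇔; dec-true; dec-false; _⊎-dec_)
open import Relation.Binary.PropositionalEquality

module ℤΣ = MonoidSum ℤP.+-0-commutativeMonoid
module ℕΣ = MonoidSum ℕP.+-0-commutativeMonoid
open CommutativeSemigroupProperties ℤP.+-commutativeSemigroup
  using () renaming (interchange to ℤ-+-interchange)
open CommutativeSemigroupProperties ℕP.+-commutativeSemigroup
  using () renaming (interchange to ℕ-+-interchange)

∑ℤ≡sum : ∀ {k} (f : Fin k → ℤ) → ∑ℤ f ≡ ℤΣ.sum f
∑ℤ≡sum {zero}  f = refl
∑ℤ≡sum {suc k} f = cong (ℤ._+_ (f zero)) (∑ℤ≡sum (f ∘ suc))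

∑ℕ≡sum : ∀ {k} (f : Fin k → ℕ) → ∑ℕ f ≡ ℕΣ.sum f
∑ℕ≡sum {zero}  f = refl
∑ℕ≡sum {suc k} f = cong (f zero ℕ.+_) (∑ℕ≡sum (f ∘ suc))

∑ℤ-cong : ∀ {k} {f g : Fin k → ℤ} → (∀ i → f i ≡ g i) → ∑ℤ f ≡ ∑ℤ g
∑ℤ-cong {zero}  f≗g = refl
∑ℤ-cong {suc k} f≗g = cong₂ ℤ._+_ (f≗g zero) (∑ℤ-cong (f≗g ∘ suc))

∑ℕ-cong : ∀ {k} {f g : Fin k → ℕ} → (∀ i → f i ≡ g i) → ∑ℕ f ≡ ∑ℕ g
∑ℕ-cong {zero}  f≗g = refl
∑ℕ-cong {suc k} f≗g = cong₂ ℕ._+_ (f≗g zero) (∑ℕ-cong (f≗g ∘ suc))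

∑ℕ-mono : ∀ {k} {f g : Fin k → ℕ} → (∀ i → f i ≤ g i) → ∑ℕ f ≤ ∑ℕ g
∑ℕ-mono {zero}  f≤g = z≤n
∑ℕ-mono {suc k} f≤g = ℕP.+-mono-≤ (f≤g zero) (∑ℕ-mono (f≤g ∘ suc))

∑ℤ-remove : ∀ {k} (i : Fin (suc k)) (f : Fin (suc k) → ℤ) →
            ∑ℤ f ≡ f i ℤ.+ ∑ℤ (f ∘ punchIn i)
∑ℤ-remove i f = begin
  ∑ℤ f                         ≡⟨ ∑ℤ≡sum f ⟩
  ℤΣ.sum f                     ≡⟨ ℤΣ.sum-remove {i = i} f ⟩
  f i ℤ.+ ℤΣ.sum (f ∘ punchIn i) ≡⟨ cong (ℤ._+_ (f i)) (∑ℤ≡sum (f ∘ punchIn i)) ⟨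
  f i ℤ.+ ∑ℤ (f ∘ punchIn i)   ∎
  where open ≡-Reasoning

∑ℕ-remove : ∀ {k} (i : Fin (suc k)) (f : Fin (suc k) → ℕ) →
            ∑ℕ f ≡ f i ℕ.+ ∑ℕ (f ∘ punchIn i)
∑ℕ-remove i f = begin
  ∑ℕ f                         ≡⟨ ∑ℕ≡sum f ⟩
  ℕΣ.sum f                     ≡⟨ ℕΣ.sum-remove {i = i} f ⟩
  f i ℕ.+ ℕΣ.sum (f ∘ punchIn i) ≡⟨ cong (f i ℕ.+_) (∑ℕ≡sum (f ∘ punchIn i)) ⟨
  f i ℕ.+ ∑ℕ (f ∘ punchIn i)   ∎
  where open ≡-Reasoning

∑ℤ-distrib-+ : ∀ {k} (f g : Fin k → ℤ) → ∑ℤ (λ i → f i ℤ.+ g i) ≡ ∑ℤ f ℤ.+ ∑ℤ g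
∑ℤ-distrib-+ f g = begin
  ∑ℤ (λ i → f i ℤ.+ g i)        ≡⟨ ∑ℤ≡sum (λ i → f i ℤ.+ g i) ⟩
  ℤΣ.sum (λ i → f i ℤ.+ g i)    ≡⟨ ℤΣ.∑-distrib-+ f g ⟩
  ℤΣ.sum f ℤ.+ ℤΣ.sum g         ≡⟨ cong₂ ℤ._+_ (∑ℤ≡sum f) (∑ℤ≡sum g) ⟨
  ∑ℤ f ℤ.+ ∑ℤ g                 ∎
  where open ≡-Reasoning

∑ℕ-distrib-+ : ∀ {k} (f g : Fin k → ℕ) → ∑ℕ (λ i → f i ℕ.+ g i) ≡ ∑ℕ f ℕ.+ ∑ℕ g
∑ℕ-distrib-+ f g = begin
  ∑ℕ (λ i → f i ℕ.+ g i)        ≡⟨ ∑ℕ≡sum (λ i → f i ℕ.+ g i) ⟩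
  ℕΣ.sum (λ i → f i ℕ.+ g i)    ≡⟨ ℕΣ.∑-distrib-+ f g ⟩
  ℕΣ.sum f ℕ.+ ℕΣ.sum g         ≡⟨ cong₂ ℕ._+_ (∑ℕ≡sum f) (∑ℕ≡sum g) ⟨
  ∑ℕ f ℕ.+ ∑ℕ g                 ∎
  where open ≡-Reasoning

maxℕ-mono : ∀ {k} {f g : Fin k → ℕ} → (∀ i → f i ≤ g i) → maxℕ f ≤ maxℕ g
maxℕ-mono {zero}  f≤g = z≤n
maxℕ-mono {suc k} f≤g = ℕP.⊔-mono-≤ (f≤g zero) (maxℕ-mono (f≤g ∘ suc))

maxℕ-upper : ∀ {k} (f : Fin k → ℕ) i → f i ≤ maxℕ f
maxℕ-upper f zero    = ℕP.m≤m⊔n _ _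
maxℕ-upper f (suc i) = ℕP.≤-trans (maxℕ-upper (f ∘ suc) i) (ℕP.m≤n⊔m _ _)

maxℕ-least : ∀ {k} {f : Fin k → ℕ} {M} → (∀ i → f i ≤ M) → maxℕ f ≤ M
maxℕ-least {zero}  f≤M = z≤n
maxℕ-least {suc k} f≤M = ℕP.⊔-lub (f≤M zero) (maxℕ-least (f≤M ∘ suc))

module _ {c ℓ} (M : Monoid c ℓ) where
  open Monoid M using (_≈_; _∙_; ε; identityˡ; identityʳ) renaming (sym to ≈-sym)

  if-∨-∙ : ∀ p q {x} → ¬ T (p ∧ q) →
           (if p ∨ q then x else ε) ≈ (if p then x else ε) ∙ (if q then x else ε)
  if-∨-∙ true  true  ¬p∧q = ⊥-elim (¬p∧q tt)
  if-∨-∙ true  false _    = ≈-sym (identityʳ _)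
  if-∨-∙ false true  _    = ≈-sym (identityˡ _)
  if-∨-∙ false false _    = ≈-sym (identityˡ _)

≟-exclusive : ∀ {k} {a b : Fin k} → a ≢ b → ∀ u → ¬ T (does (u ≟ a) ∧ does (u ≟ b))
≟-exclusive {a = a} {b} a≢b u with u ≟ a | u ≟ b
... | yes u≡a | yes u≡b = λ _ → a≢b (trans (sym u≡a) u≡b)
... | yes _   | no _    = λ ()
... | no _    | _       = λ ()

[a+b]-[c+d]≡[a-c]+[b-d] : ∀ a b c d → (a ℤ.+ b) - (c ℤ.+ d) ≡ (a - c) ℤ.+ (b - d)
[a+b]-[c+d]≡[a-c]+[b-d] a b c d =
  trans (cong (ℤ._+_ (a ℤ.+ b)) (ℤP.neg-distrib-+ c d)) (ℤ-+-interchange a b (ℤ.- c) (ℤ.- d))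

even⇒2∣ : ∀ {d} → Σ ℕ (λ k → d ≡ 2 ℕ.* k) → 2 ℕD.∣ d
even⇒2∣ (k , d≡2k) = divides k (trans d≡2k (ℕP.*-comm 2 k))

2∣⇒even : ∀ {d} → 2 ℕD.∣ d → Σ ℕ (λ k → d ≡ 2 ℕ.* k)
2∣⇒even (divides k d≡k2) = k , trans d≡k2 (ℕP.*-comm k 2)

2∣n+n : ∀ n → 2 ℕD.∣ n ℕ.+ n
2∣n+n n = even⇒2∣ (n , cong (n ℕ.+_) (sym (ℕP.+-identityʳ n)))

delete : ∀ {n m} → Graph n (suc m) → Fin (suc m) → Graph n m
delete G e = record { tl = tl G ∘ punchIn e ; hd = hd G ∘ punchIn e }

relabel : ∀ {n k m} → (Fin n → Fin k) → Graph n m → Graph k m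
relabel σ G = record { tl = σ ∘ tl G ; hd = σ ∘ hd G }

edgeflow : ∀ {n m} → Graph n m → (Fin m → ℤ) → Fin n → Fin m → ℤ
edgeflow G f v x = (if does (hd G x ≟ v) then f x else 0ℤ) - (if does (tl G x ≟ v) then f x else 0ℤ)

edgedeg : ∀ {n m} → Graph n m → SubG m → Fin n → Fin m → ℕ
edgedeg G H v x =
  if lookup H x then (if does (hd G x ≟ v) then 1 else 0) ℕ.+ (if does (tl G x ≟ v) then 1 else 0) else 0

netflow-cong : ∀ {n m} (G : Graph n m) {f g : Fin m → ℤ} → (∀ x → f x ≡ g x) →
               ∀ v → netflow G f v ≡ netflow G g v
netflow-cong G f≗g v = ∑ℤ-cong λ x →
  cong (λ a → (if does (hd G x ≟ v) then a else 0ℤ) - (if does (tl G x ≟ v) then a else 0ℤ)) (f≗g x)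

netflow-removeAt : ∀ {n m} (G : Graph n (suc m)) (e : Fin (suc m)) (F : Fin (suc m) → ℤ) v →
  netflow G F v ≡ edgeflow G F v e ℤ.+ netflow (delete G e) (removeAt F e) v
netflow-removeAt G e F v = ∑ℤ-remove e (edgeflow G F v)

deg-removeAt : ∀ {n m} (G : Graph n (suc m)) (e : Fin (suc m)) (H : SubG (suc m)) v →
  deg G H v ≡ edgedeg G H v e ℕ.+ deg (delete G e) (contractSub e H) v
deg-removeAt G e H v = trans (∑ℕ-remove e (edgedeg G H v)) (cong (edgedeg G H v e ℕ.+_) (∑ℕ-cong λ y →
  cong (λ b → if b then _ else 0) (sym (lookup∘tabulate (lookup H ∘ punchIn e) y))))

module _ {n k m} (σ : Fin n → Fin k) (G : Graph n m) {s : Fin k} where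

  private
    if-fibre : ∀ {P : Set} {u} → (σ u ≡ s ⇔ P) → (P? : Dec P) → ∀ {ℓ} {A : Set ℓ} (x z : A) →
               (if does (σ u ≟ s) then x else z) ≡ (if does P? then x else z)
    if-fibre {u = u} fibre P? x z = cong (λ b → if b then x else z) (does-⇔ fibre (σ u ≟ s) P?)

  module _ {w : Fin n} (fibre : ∀ u → σ u ≡ s ⇔ u ≡ w) where

    netflow-relabel-singleton : ∀ f → netflow (relabel σ G) f s ≡ netflow G f w
    netflow-relabel-singleton f = ∑ℤ-cong λ x →
      cong₂ _-_ (if-fibre (fibre (hd G x)) (hd G x ≟ w) (f x) 0ℤ)
                (if-fibre (fibre (tl G x)) (tl G x ≟ w) (f x) 0ℤ)

    deg-relabel-singleton : ∀ H → deg (relabel σ G) H s ≡ deg G H w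
    deg-relabel-singleton H = ∑ℕ-cong λ x → cong (λ c → if lookup H x then c else 0)
      (cong₂ ℕ._+_ (if-fibre (fibre (hd G x)) (hd G x ≟ w) 1 0) (if-fibre (fibre (tl G x)) (tl G x ≟ w) 1 0))

  module _ {a b : Fin n} (a≢b : a ≢ b) (fibre : ∀ u → σ u ≡ s ⇔ (u ≡ a ⊎ u ≡ b)) where

    private
      if-split : ∀ {c ℓ} (M : Monoid c ℓ) u → let open Monoid M in ∀ x →
                 (if does (σ u ≟ s) then x else ε)
                   ≈ (if does (u ≟ a) then x else ε) ∙ (if does (u ≟ b) then x else ε)
      if-split M u x = Monoid.trans M (Monoid.reflexive M (if-fibre (fibre u) ((u ≟ a) ⊎-dec (u ≟ b)) x _))
                                      (if-∨-∙ M (does (u ≟ a)) (does (u ≟ b)) (≟-exclusive a≢b u))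

    netflow-relabel-pair : ∀ f → netflow (relabel σ G) f s ≡ netflow G f a ℤ.+ netflow G f b
    netflow-relabel-pair f = trans (∑ℤ-cong edge) (∑ℤ-distrib-+ (edgeflow G f a) (edgeflow G f b))
      where
      edge : ∀ x → edgeflow (relabel σ G) f s x ≡ edgeflow G f a x ℤ.+ edgeflow G f b x
      edge x = trans (cong₂ _-_ (if-split ℤP.+-0-monoid (hd G x) (f x)) (if-split ℤP.+-0-monoid (tl G x) (f x)))
                     ([a+b]-[c+d]≡[a-c]+[b-d] (into a) (into b) (out a) (out b))
        where
        into out : Fin n → ℤ
        into v = if does (hd G x ≟ v) then f x else 0ℤ
        out  v = if does (tl G x ≟ v) then f x else 0ℤ

    deg-relabel-pair : ∀ H → deg (relabel σ G) H s ≡ deg G H a ℕ.+ deg G H b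
    deg-relabel-pair H = trans (∑ℕ-cong edge) (∑ℕ-distrib-+ (edgedeg G H a) (edgedeg G H b))
      where
      edge : ∀ x → edgedeg (relabel σ G) H s x ≡ edgedeg G H a x ℕ.+ edgedeg G H b x
      edge x with lookup H x
      ... | false = refl
      ... | true  = trans (cong₂ ℕ._+_ (if-split ℕP.+-0-monoid (hd G x) 1) (if-split ℕP.+-0-monoid (tl G x) 1))
                          (ℕ-+-interchange (into a) (into b) (out a) (out b))
        where
        into out : Fin n → ℕ
        into v = if does (hd G x ≟ v) then 1 else 0
        out  v = if does (tl G x ≟ v) then 1 else 0

module Contraction {n m} (G : Graph (suc n) (suc m)) (e : Fin (suc m)) (nl : hd G e ≢ tl G e) where

  private
    h t : Fin (suc n)
    h = hd G e
    t = tl G e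

    G∖e : Graph (suc n) m
    G∖e = delete G e

    -- definitionally relabel (mergeV nl) G∖e, so the relabelling lemmas apply to it as is
    G/e : Graph n m
    G/e = contract G e nl

  mergeV-≢ : ∀ {u} (h≢u : h ≢ u) → mergeV nl u ≡ punchOut h≢u
  mergeV-≢ {u} h≢u with h ≟ u
  ... | yes h≡u = ⊥-elim (h≢u h≡u)
  ... | no _    = punchOut-cong h refl

  mergeV-head : mergeV nl h ≡ mergeV nl t
  mergeV-head with h ≟ h
  ... | yes _   = sym (mergeV-≢ nl)
  ... | no h≢h  = ⊥-elim (h≢h refl)

  mergeV-injective : ∀ {u w} → h ≢ u → h ≢ w → mergeV nl u ≡ mergeV nl w → u ≡ w
  mergeV-injective h≢u h≢w eq =
    punchOut-injective h≢u h≢w (trans (sym (mergeV-≢ h≢u)) (trans eq (mergeV-≢ h≢w)))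

  mergeV-punchIn : ∀ v → mergeV nl (punchIn h v) ≡ v
  mergeV-punchIn v = trans (mergeV-≢ (punchInᵢ≢i h v ∘ sym)) (punchOut-punchIn h)

  mergeV-fibre-merged : ∀ u → mergeV nl u ≡ mergeV nl t ⇔ (u ≡ h ⊎ u ≡ t)
  mergeV-fibre-merged u = mk⇔ to from
    where
    to : mergeV nl u ≡ mergeV nl t → u ≡ h ⊎ u ≡ t
    to eq = case h ≟ u of λ where
      (yes h≡u) → inj₁ (sym h≡u)
      (no h≢u)  → inj₂ (mergeV-injective h≢u nl eq)
    from : u ≡ h ⊎ u ≡ t → mergeV nl u ≡ mergeV nl t
    from (inj₁ refl) = mergeV-head
    from (inj₂ refl) = refl

  mergeV-fibre-unmerged : ∀ {w} → w ≢ h → w ≢ t → ∀ u → mergeV nl u ≡ mergeV nl w ⇔ u ≡ w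
  mergeV-fibre-unmerged {w} w≢h w≢t u = mk⇔ to (cong (mergeV nl))
    where
    to : mergeV nl u ≡ mergeV nl w → u ≡ w
    to eq = case h ≟ u of λ where
      (yes refl) → ⊥-elim (w≢t (sym (mergeV-injective nl (w≢h ∘ sym) (trans (sym mergeV-head) eq))))
      (no h≢u)   → mergeV-injective h≢u (w≢h ∘ sym) eq

  data EndpointView : Fin (suc n) → Set where
    at-head  : EndpointView h
    at-tail  : EndpointView t
    off-edge : ∀ {w} → w ≢ h → w ≢ t → EndpointView w

  endpointView : ∀ v → EndpointView v
  endpointView v with v ≟ h | v ≟ t
  ... | yes refl | _        = at-head
  ... | no _     | yes refl = at-tail
  ... | no v≢h   | no v≢t   = off-edge v≢h v≢t

  data MergeView : Fin n → Set where
    merged   : MergeView (mergeV nl t)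
    unmerged : ∀ {w} → w ≢ h → w ≢ t → MergeView (mergeV nl w)

  mergeView : ∀ v → MergeView v
  mergeView v with punchIn h v ≟ t
  ... | yes w≡t = subst MergeView (trans (cong (mergeV nl) (sym w≡t)) (mergeV-punchIn v)) merged
  ... | no w≢t  = subst MergeView (mergeV-punchIn v) (unmerged (punchInᵢ≢i h v) w≢t)

  edgeflow-head : ∀ F → edgeflow G F h e ≡ F e
  edgeflow-head F rewrite dec-true (h ≟ h) refl | dec-false (t ≟ h) (nl ∘ sym) = ℤP.+-identityʳ (F e)

  edgeflow-tail : ∀ F → edgeflow G F t e ≡ ℤ.- F e
  edgeflow-tail F rewrite dec-false (h ≟ t) nl | dec-true (t ≟ t) refl = ℤP.+-identityˡ (ℤ.- F e)

  edgeflow-off : ∀ F {w} → w ≢ h → w ≢ t → edgeflow G F w e ≡ 0ℤ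
  edgeflow-off F w≢h w≢t rewrite dec-false (h ≟ _) (w≢h ∘ sym) | dec-false (t ≟ _) (w≢t ∘ sym) = refl

  edgedeg-head : ∀ H → edgedeg G H h e ≡ (if lookup H e then 1 else 0)
  edgedeg-head H rewrite dec-true (h ≟ h) refl | dec-false (t ≟ h) (nl ∘ sym) = refl

  edgedeg-tail : ∀ H → edgedeg G H t e ≡ (if lookup H e then 1 else 0)
  edgedeg-tail H rewrite dec-false (h ≟ t) nl | dec-true (t ≟ t) refl = refl

  edgedeg-off : ∀ H {w} → w ≢ h → w ≢ t → edgedeg G H w e ≡ 0
  edgedeg-off H w≢h w≢t rewrite dec-false (h ≟ _) (w≢h ∘ sym) | dec-false (t ≟ _) (w≢t ∘ sym) with lookup H e
  ... | true  = refl
  ... | false = refl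

  netflow-contract-merged : ∀ F →
    netflow G/e (removeAt F e) (mergeV nl t) ≡ netflow G F h ℤ.+ netflow G F t
  netflow-contract-merged F = begin
    netflow G/e f (mergeV nl t)          ≡⟨ netflow-relabel-pair (mergeV nl) G∖e nl mergeV-fibre-merged f ⟩
    X ℤ.+ Y                              ≡⟨ ℤP.+-identityˡ (X ℤ.+ Y) ⟨
    0ℤ ℤ.+ (X ℤ.+ Y)                     ≡⟨ cong (ℤ._+ (X ℤ.+ Y)) (ℤP.+-inverseʳ (F e)) ⟨
    (F e ℤ.+ ℤ.- F e) ℤ.+ (X ℤ.+ Y)      ≡⟨ ℤ-+-interchange (F e) X (ℤ.- F e) Y ⟨
    (F e ℤ.+ X) ℤ.+ (ℤ.- F e ℤ.+ Y)      ≡⟨ cong₂ ℤ._+_ (cong (ℤ._+ X) (edgeflow-head F))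
                                                       (cong (ℤ._+ Y) (edgeflow-tail F)) ⟨
    (edgeflow G F h e ℤ.+ X) ℤ.+ (edgeflow G F t e ℤ.+ Y)
                                         ≡⟨ cong₂ ℤ._+_ (netflow-removeAt G e F h) (netflow-removeAt G e F t) ⟨
    netflow G F h ℤ.+ netflow G F t      ∎
    where
    open ≡-Reasoning
    f = removeAt F e
    X = netflow G∖e f h
    Y = netflow G∖e f t

  netflow-contract-unmerged : ∀ F {w} → w ≢ h → w ≢ t →
    netflow G/e (removeAt F e) (mergeV nl w) ≡ netflow G F w
  netflow-contract-unmerged F {w} w≢h w≢t = begin
    netflow G/e f (mergeV nl w)  ≡⟨ netflow-relabel-singleton (mergeV nl) G∖e (mergeV-fibre-unmerged w≢h w≢t) f ⟩
    netflow G∖e f w              ≡⟨ ℤP.+-identityˡ (netflow G∖e f w) ⟨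
    0ℤ ℤ.+ netflow G∖e f w       ≡⟨ cong (ℤ._+ netflow G∖e f w) (edgeflow-off F w≢h w≢t) ⟨
    edgeflow G F w e ℤ.+ netflow G∖e f w ≡⟨ netflow-removeAt G e F w ⟨
    netflow G F w                ∎
    where
    open ≡-Reasoning
    f = removeAt F e

  deg-contract-merged : ∀ H → let b = if lookup H e then 1 else 0 in
    deg G H h ℕ.+ deg G H t ≡ (b ℕ.+ b) ℕ.+ deg G/e (contractSub e H) (mergeV nl t)
  deg-contract-merged H = begin
    deg G H h ℕ.+ deg G H t              ≡⟨ cong₂ ℕ._+_ (deg-removeAt G e H h) (deg-removeAt G e H t) ⟩
    (edgedeg G H h e ℕ.+ X) ℕ.+ (edgedeg G H t e ℕ.+ Y)
                                         ≡⟨ cong₂ ℕ._+_ (cong (ℕ._+ X) (edgedeg-head H))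
                                                        (cong (ℕ._+ Y) (edgedeg-tail H)) ⟩
    (b ℕ.+ X) ℕ.+ (b ℕ.+ Y)              ≡⟨ ℕ-+-interchange b X b Y ⟩
    (b ℕ.+ b) ℕ.+ (X ℕ.+ Y)              ≡⟨ cong ((b ℕ.+ b) ℕ.+_)
                                                 (deg-relabel-pair (mergeV nl) G∖e nl mergeV-fibre-merged H′) ⟨
    (b ℕ.+ b) ℕ.+ deg G/e H′ (mergeV nl t) ∎
    where
    open ≡-Reasoning
    b = if lookup H e then 1 else 0
    H′ = contractSub e H
    X = deg G∖e H′ h
    Y = deg G∖e H′ t

  deg-contract-unmerged : ∀ H {w} → w ≢ h → w ≢ t →
    deg G/e (contractSub e H) (mergeV nl w) ≡ deg G H w
  deg-contract-unmerged H {w} w≢h w≢t = begin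
    deg G/e H′ (mergeV nl w)      ≡⟨ deg-relabel-singleton (mergeV nl) G∖e (mergeV-fibre-unmerged w≢h w≢t) H′ ⟩
    deg G∖e H′ w                  ≡⟨ cong (ℕ._+ deg G∖e H′ w) (edgedeg-off H w≢h w≢t) ⟨
    edgedeg G H w e ℕ.+ deg G∖e H′ w ≡⟨ deg-removeAt G e H w ⟨
    deg G H w                     ∎
    where
    open ≡-Reasoning
    H′ = contractSub e H

  contract-isEven : ∀ H → IsEven G H → IsEven G/e (contractSub e H)
  contract-isEven H even v with mergeView v
  ... | merged = 2∣⇒even (∣m+n∣m⇒∣n
          (subst (2 ℕD.∣_) (deg-contract-merged H) (∣m∣n⇒∣m+n (even⇒2∣ (even h)) (even⇒2∣ (even t))))
          (2∣n+n (if lookup H e then 1 else 0)))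
  ... | unmerged w≢h w≢t =
          subst (λ d → Σ ℕ λ k → d ≡ 2 ℕ.* k) (sym (deg-contract-unmerged H w≢h w≢t)) (even _)

  contract-isEulerChi : ∀ H χ → IsEulerChi G H χ → IsEulerChi G/e (contractSub e H) (removeAt χ e)
  contract-isEulerChi H χ (on-H , off-H , balanced) =
    (λ y y∈H′ → on-H (punchIn e y) (trans (sym (lookup∘tabulate _ y)) y∈H′)) ,
    (λ y y∉H′ → off-H (punchIn e y) (trans (sym (lookup∘tabulate _ y)) y∉H′)) ,
    balanced′
    where
    balanced′ : ∀ v → netflow G/e (removeAt χ e) v ≡ 0ℤ
    balanced′ v with mergeView v
    ... | merged           = trans (netflow-contract-merged χ) (cong₂ ℤ._+_ (balanced h) (balanced t))
    ... | unmerged w≢h w≢t = trans (netflow-contract-unmerged χ w≢h w≢t) (balanced _)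

  liftFlow : (Fin m → ℤ) → Fin (suc m) → ℤ
  liftFlow f = insertAt f e (ℤ.- netflow G∖e f h)

  removeAt-liftFlow : ∀ f y → removeAt (liftFlow f) e y ≡ f y
  removeAt-liftFlow f = removeAt-insertAt f e _

  netflow-liftFlow-head : ∀ f → netflow G (liftFlow f) h ≡ 0ℤ
  netflow-liftFlow-head f = begin
    netflow G F h                               ≡⟨ netflow-removeAt G e F h ⟩
    edgeflow G F h e ℤ.+ netflow G∖e (removeAt F e) h
                                                ≡⟨ cong₂ ℤ._+_ (trans (edgeflow-head F) (insertAt-lookup f e _))
                                                               (netflow-cong G∖e (removeAt-liftFlow f) h) ⟩
    ℤ.- netflow G∖e f h ℤ.+ netflow G∖e f h     ≡⟨ ℤP.+-inverseˡ (netflow G∖e f h) ⟩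
    0ℤ                                          ∎
    where
    open ≡-Reasoning
    F = liftFlow f

  netflow-liftFlow-tail : ∀ f → netflow G/e f (mergeV nl t) ≡ netflow G (liftFlow f) t
  netflow-liftFlow-tail f = begin
    netflow G/e f (mergeV nl t)                 ≡⟨ netflow-cong G/e (sym ∘ removeAt-liftFlow f) (mergeV nl t) ⟩
    netflow G/e (removeAt F e) (mergeV nl t)    ≡⟨ netflow-contract-merged F ⟩
    netflow G F h ℤ.+ netflow G F t             ≡⟨ cong (ℤ._+ netflow G F t) (netflow-liftFlow-head f) ⟩
    0ℤ ℤ.+ netflow G F t                        ≡⟨ ℤP.+-identityˡ (netflow G F t) ⟩
    netflow G F t                               ∎
    where
    open ≡-Reasoning
    F = liftFlow f

  netflow-liftFlow-unmerged : ∀ f {w} → w ≢ h → w ≢ t →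
    netflow G/e f (mergeV nl w) ≡ netflow G (liftFlow f) w
  netflow-liftFlow-unmerged f w≢h w≢t = trans (netflow-cong G/e (sym ∘ removeAt-liftFlow f) _)
                                              (netflow-contract-unmerged (liftFlow f) w≢h w≢t)

  liftFlow-isFlowMod : ∀ q f → IsFlowMod G/e q f → IsFlowMod G q (liftFlow f)
  liftFlow-isFlowMod q f flow v with endpointView v
  ... | at-head          = subst (+ q ∣ℤ_) (sym (netflow-liftFlow-head f)) (q ∣0)
  ... | at-tail          = subst (+ q ∣ℤ_) (netflow-liftFlow-tail f) (flow (mergeV nl t))
  ... | off-edge w≢h w≢t = subst (+ q ∣ℤ_) (netflow-liftFlow-unmerged f w≢h w≢t) (flow (mergeV nl v))

  contract-generates : ∀ {r} q (χ : Fin r → Fin (suc m) → ℤ) → Generates G q χ →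
                       Generates G/e q (λ i → removeAt (χ i) e)
  contract-generates q χ generates f flow with generates (liftFlow f) (liftFlow-isFlowMod q f flow)
  ... | a , F≡∑aχ = a , λ y →
    subst (λ z → + q ∣ℤ z - ∑ℤ (λ i → a i ℤ.* χ i (punchIn e y)))
          (insertAt-punchIn f e _ y) (F≡∑aχ (punchIn e y))

  contract-evenGenSet : ∀ {r} q (C : Fin r → SubG (suc m)) → EvenGenSet G q C →
                        EvenGenSet G/e q (λ i → contractSub e (C i))
  contract-evenGenSet q C (even , χ , euler , generates) =
    (λ i → contract-isEven (C i) (even i)) ,
    (λ i → removeAt (χ i) e) ,
    (λ i → contract-isEulerChi (C i) (χ i) (euler i)) ,
    contract-generates q χ generates

∣contractSub∣≤ : ∀ {m} (e : Fin (suc m)) (H : Subset (suc m)) → ∣ contractSub e H ∣ ≤ ∣ H ∣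
∣contractSub∣≤ zero (true ∷ H) rewrite tabulate∘lookup H = ℕP.n≤1+n _
∣contractSub∣≤ zero (false ∷ H) rewrite tabulate∘lookup H = ℕP.≤-refl
∣contractSub∣≤ {suc m} (suc e) (true ∷ H) = s≤s (∣contractSub∣≤ e H)
∣contractSub∣≤ {suc m} (suc e) (false ∷ H) = ∣contractSub∣≤ e H

contractSub-∩ : ∀ {m} (e : Fin (suc m)) (A B : Subset (suc m)) →
                contractSub e A ∩ contractSub e B ≡ contractSub e (A ∩ B)
contractSub-∩ e A B = trans (sym (tabulate∘lookup (A′ ∩ B′))) (tabulate-cong λ x → begin
  lookup (A′ ∩ B′) x                               ≡⟨ lookup-zipWith _∧_ x A′ B′ ⟩
  lookup A′ x ∧ lookup B′ x                        ≡⟨ cong₂ _∧_ (lookup∘tabulate _ x) (lookup∘tabulate _ x) ⟩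
  lookup A (punchIn e x) ∧ lookup B (punchIn e x)  ≡⟨ lookup-zipWith _∧_ (punchIn e x) A B ⟨
  lookup (A ∩ B) (punchIn e x)                     ∎)
  where
  open ≡-Reasoning
  A′ = contractSub e A
  B′ = contractSub e B

nonempty?-mono : ∀ {m k} (X : Subset m) (Y : Subset k) → ∣ X ∣ ≤ ∣ Y ∣ →
                 (if nonempty? X then 1 else 0) ≤ (if nonempty? Y then 1 else 0)
nonempty?-mono X Y ∣X∣≤∣Y∣ with ∣ X ∣ | ∣ Y ∣
... | zero  | _     = z≤n
... | suc _ | suc _ = s≤s z≤n

module _ {m r} (C : Fin r → SubG (suc m)) (e : Fin (suc m)) where

  private
    C/e : Fin r → SubG m
    C/e i = contractSub e (C i)

    ∣∩∣-contract : ∀ i j → ∣ C/e i ∩ C/e j ∣ ≤ ∣ C i ∩ C j ∣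
    ∣∩∣-contract i j rewrite contractSub-∩ e (C i) (C j) = ∣contractSub∣≤ e (C i ∩ C j)

  dPar-contract : dPar C/e ≤ dPar C
  dPar-contract = maxℕ-mono λ i → ∑ℕ-mono λ j → meets i j
    where
    meets : ∀ i j → (if does (i ≟ j) then 0 else (if nonempty? (C/e i ∩ C/e j) then 1 else 0))
                  ≤ (if does (i ≟ j) then 0 else (if nonempty? (C i ∩ C j) then 1 else 0))
    meets i j with i ≟ j
    ... | yes _ = z≤n
    ... | no _  = nonempty?-mono (C/e i ∩ C/e j) (C i ∩ C j) (∣∩∣-contract i j)

  ιPar-contract : ιPar C/e ≤ ιPar C
  ιPar-contract = maxℕ-mono λ i → maxℕ-mono λ j → shared i j
    where
    shared : ∀ i j → (if does (i ≟ j) then 0 else ∣ C/e i ∩ C/e j ∣)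
                   ≤ (if does (i ≟ j) then 0 else ∣ C i ∩ C j ∣)
    shared i j with i ≟ j
    ... | yes _ = z≤n
    ... | no _  = ∣∩∣-contract i j

  ℓPar-contract : ℓPar C/e ≤ ℓPar C
  ℓPar-contract = maxℕ-mono λ i → ∣contractSub∣≤ e (C i)

  sPar-contract : sPar C/e ≤ sPar C
  sPar-contract = maxℕ-least λ y → ℕP.≤-trans
    (ℕP.≤-reflexive (∑ℕ-cong λ i →
      cong (λ b → if b then 1 else 0) (lookup∘tabulate (lookup (C i) ∘ punchIn e) y)))
    (maxℕ-upper (λ x → ∑ℕ (λ i → if lookup (C i) x then 1 else 0)) (punchIn e y))

lemma2p5 : ∀ {n m r} (G : Graph (suc n) (suc m)) (q : ℕ)
             (C : Fin r → SubG (suc m)) → EvenGenSet G q C →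
             (e : Fin (suc m)) (nl : hd G e ≢ tl G e) →
             EvenGenSet (contract G e nl) q (λ i → contractSub e (C i))
             × dPar (λ i → contractSub e (C i)) ≤ dPar C
             × ιPar (λ i → contractSub e (C i)) ≤ ιPar C
             × ℓPar (λ i → contractSub e (C i)) ≤ ℓPar C
             × sPar (λ i → contractSub e (C i)) ≤ sPar C
lemma2p5 G q C C-evenGenSet e nl =
  Contraction.contract-evenGenSet G e nl q C C-evenGenSet ,
  dPar-contract C e , ιPar-contract C e , ℓPar-contract C e , sPar-contract C e
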